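{- Let $\Gamma$ be a $1$-walk-regular graph containing a regular clique. Then $\Gamma$ is a strongly regular graph.
   Context: A graph is $t$-walk-regular if, for every $\ell\ge 0$, the number of walks of length $\ell$ between two vertices $x,y$ depends only on the distance between $x$ and $y$, provided this distance is at most $t$. (In particular a $1$-walk-regular graph is regular.) A clique $C$ in a regular graph is a regular clique if every vertex outside $C$ is adjacent to the same positive number of vertices of $C$. -}

module Defs where

open import Data.Nat using (ℕ; zero; suc; _≤_; _<_)
open import Data.Bool using (Bool; true; false; if_then_else_; _∧_)
open import Data.Fin using (Fin; _≟_)
open import Data.List using (map; allFin)
open import Data.Nat.ListAction using (sum)
open import Data.Product using (Σ; _×_; ∃)
open import Relation.Nullary using (¬_)
open import Relation.Nullary.Decidable using (⌊_⌋)
open import Relation.Binary.PropositionalEquality using (_≡_)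

record Graph (n : ℕ) : Set where
  field
    adj    : Fin n → Fin n → Bool
    sym    : ∀ x y → adj x y ≡ adj y x
    irrefl : ∀ x → adj x x ≡ false
open Graph public

count : ∀ {n} → (Fin n → Bool) → ℕ
count {n} p = sum (map (λ i → if p i then 1 else 0) (allFin n))

walks : ∀ {n} → Graph n → ℕ → Fin n → Fin n → ℕ
walks G zero    x y = if ⌊ x ≟ y ⌋ then 1 else 0
walks {n} G (suc ℓ) x y =
  sum (map (λ z → if adj G x z then walks G ℓ z y else 0) (allFin n))

Dist : ∀ {n} → Graph n → Fin n → Fin n → ℕ → Set
Dist G x y d = (1 ≤ walks G d x y) × (∀ e → e < d → walks G e x y ≡ 0)

WalkRegular : ∀ {n} → ℕ → Graph n → Set
WalkRegular {n} t G =
  ∀ (d : ℕ) → d ≤ t → (x y x' y' : Fin n) →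
  Dist G x y d → Dist G x' y' d →
  ∀ (ℓ : ℕ) → walks G ℓ x y ≡ walks G ℓ x' y'

IsClique : ∀ {n} → Graph n → (Fin n → Bool) → Set
IsClique {n} G C =
  ∀ (x y : Fin n) → C x ≡ true → C y ≡ true → ¬ (x ≡ y) → adj G x y ≡ true

IsRegularClique : ∀ {n} → Graph n → (Fin n → Bool) → Set
IsRegularClique {n} G C =
  IsClique G C ×
  Σ ℕ (λ m → (1 ≤ m) ×
    (∀ (x : Fin n) → C x ≡ false → count (λ z → C z ∧ adj G x z) ≡ m))

commonNbrs : ∀ {n} → Graph n → Fin n → Fin n → ℕ
commonNbrs G x y = count (λ z → adj G x z ∧ adj G y z)

IsStronglyRegular : ∀ {n} → Graph n → Set
IsStronglyRegular {n} G =
  Σ ℕ λ k → Σ ℕ λ lam → Σ ℕ λ mu →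
    (∀ (x : Fin n) → count (adj G x) ≡ k) ×
    (∀ (x y : Fin n) → adj G x y ≡ true → commonNbrs G x y ≡ lam) ×
    (∀ (x y : Fin n) → ¬ (x ≡ y) → adj G x y ≡ false → commonNbrs G x y ≡ mu)

-- Let A be the adjacency matrix, k the valency, χ the indicator vector of the regular clique C,
-- c = |C| and θ = c − 1 − m. Regularity of C says Aχ = θχ + m𝟏, so (A − k)(A − θ)χ = 0.
-- Walk-regularity makes the diagonal entries D_s of A^s constant, and the entries of A^s on edges
-- constant; counting walks from a vertex of C back into C gives k·χᵀA^sχ = c·(k D_s + (c − 1) D_{s+1}).
-- Consequently, for every vertex x, the vector (A − k)(A − θ)(k + (c − 1)A)e_x is orthogonal to all
-- A^j e_x while lying in their span, so it vanishes: f = (A − θ)(k + (c − 1)A)e_x is a k-eigenvector.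
-- On a k-regular graph such a vector is constant along edges, hence constant, since every vertex is
-- in C or adjacent to it. Evaluating f at a non-neighbour y of x gives (c − 1)·μ(x, y) = (c − 1)k − θk,
-- which fixes μ when c ≠ 1; when c = 1 it reads mk = 0, impossible once a non-edge exists.
module Submission where

open import Defs hiding (sym)
open import Data.Bool as Bool using (Bool; true; false; if_then_else_; _∧_)
open import Data.Bool.Properties using (∧-idem; ∧-zeroʳ)
open import Data.Fin as Fin using (Fin) renaming (zero to fzero; suc to fsuc)
open import Data.Fin.Properties using (any?)
open import Data.Integer using (ℤ; +_; -[1+_]; 0ℤ; 1ℤ; _+_; _*_; _-_; -_; _≤_; +≤+; _≟_; ≢-nonZero)
open import Data.Integer.Properties
  using ( +-*-semiring; +-mono-≤; +-identityˡ; +-identityʳ; +-inverseʳ; +-injective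
        ; *-assoc; *-comm; *-identityˡ; *-identityʳ; *-zeroʳ; *-distribˡ-+; *-distribʳ-+; *-cancelˡ-≡
        ; neg-distribˡ-*; i-j≡0⇒i≡j; i*j≡0⇒i≡0∨j≡0 )
open import Data.Integer.Tactic.RingSolver using (solve-∀)
open import Data.List using (map; allFin; tabulate)
open import Data.List.Properties using (map-tabulate)
open import Data.Nat as ℕ using (ℕ; zero; suc; z≤n; s≤s)
import Data.Nat.ListAction as ℕ
open import Data.Nat.Properties using (≤-refl)
open import Data.Product using (Σ; ∃; _,_; _×_; proj₁; proj₂)
open import Data.Sum using (_⊎_; inj₁; inj₂; [_,_]′)
open import Data.Vec.Functional using (Vector)
open import Function using (_∘_)
open import Relation.Binary.PropositionalEquality
open import Relation.Nullary using (¬_; Dec; yes; no; contradiction)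
open import Relation.Nullary.Decidable using (⌊_⌋; ¬?; _×-dec_)

open import Algebra.Properties.Semiring.Sum +-*-semiring
  using (sum; sum-syntax; sum-cong-≗; sum-replicate-zero; ∑-distrib-+; ∑-comm; *-distribˡ-sum; *-distribʳ-sum)

𝟙 : Bool → ℤ
𝟙 b = + (if b then 1 else 0)

+sum-map-allFin : ∀ {n} (f : Fin n → ℕ) → + ℕ.sum (map f (allFin n)) ≡ sum (+_ ∘ f)
+sum-map-allFin {n} f = trans (cong (+_ ∘ ℕ.sum) (map-tabulate (λ i → i) f)) (+sum-tabulate f)
  where
    +sum-tabulate : ∀ {m} (g : Fin m → ℕ) → + ℕ.sum (tabulate g) ≡ sum (+_ ∘ g)
    +sum-tabulate {zero}  g = refl
    +sum-tabulate {suc m} g = cong (_+_ (+ g fzero)) (+sum-tabulate (g ∘ fsuc))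

+count : ∀ {n} (p : Fin n → Bool) → + count p ≡ sum (𝟙 ∘ p)
+count p = +sum-map-allFin (λ i → if p i then 1 else 0)

0≤i*i : ∀ i → 0ℤ ≤ i * i
0≤i*i (+ zero)    = +≤+ z≤n
0≤i*i (+ suc n)   = +≤+ z≤n
0≤i*i -[1+ n ]    = +≤+ z≤n

i*i≡0⇒i≡0 : ∀ i → i * i ≡ 0ℤ → i ≡ 0ℤ
i*i≡0⇒i≡0 i eq with i*j≡0⇒i≡0∨j≡0 i eq
... | inj₁ i≡0 = i≡0
... | inj₂ i≡0 = i≡0

∑-nonNegative : ∀ {n} {f : Fin n → ℤ} → (∀ i → 0ℤ ≤ f i) → 0ℤ ≤ sum f
∑-nonNegative {zero}  _   = +≤+ z≤n
∑-nonNegative {suc n} f≥0 = +-mono-≤ (f≥0 fzero) (∑-nonNegative (f≥0 ∘ fsuc))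

+-nonNegative-≡0 : ∀ {a b} → 0ℤ ≤ a → 0ℤ ≤ b → a + b ≡ 0ℤ → a ≡ 0ℤ × b ≡ 0ℤ
+-nonNegative-≡0 (+≤+ {n = 0} _) (+≤+ {n = 0} _) _ = refl , refl

∑-nonNegative-≡0 : ∀ {n} {f : Fin n → ℤ} → (∀ i → 0ℤ ≤ f i) → sum f ≡ 0ℤ → ∀ i → f i ≡ 0ℤ
∑-nonNegative-≡0 f≥0 ∑f≡0 fzero    = proj₁ (+-nonNegative-≡0 (f≥0 fzero) (∑-nonNegative (f≥0 ∘ fsuc)) ∑f≡0)
∑-nonNegative-≡0 f≥0 ∑f≡0 (fsuc i) =
  ∑-nonNegative-≡0 (f≥0 ∘ fsuc) (proj₂ (+-nonNegative-≡0 (f≥0 fzero) (∑-nonNegative (f≥0 ∘ fsuc)) ∑f≡0)) i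

∑-zero : ∀ {n} {f : Fin n → ℤ} → (∀ i → f i ≡ 0ℤ) → sum f ≡ 0ℤ
∑-zero {n} f≡0 = trans (sum-cong-≗ f≡0) (sum-replicate-zero n)

∑-δ : ∀ {n} (v : Fin n → ℤ) x → ∑[ y < n ] (v y * 𝟙 ⌊ y Fin.≟ x ⌋) ≡ v x
∑-δ {suc n} v fzero     = trans (cong₂ _+_ (*-identityʳ (v fzero)) (∑-zero (λ y → *-zeroʳ (v (fsuc y)))))
                                (+-identityʳ (v fzero))
∑-δ {suc n} v (fsuc x) = begin
  v fzero * 0ℤ + ∑[ y < n ] (v (fsuc y) * 𝟙 ⌊ fsuc y Fin.≟ fsuc x ⌋)  ≡⟨ cong₂ _+_ (*-zeroʳ (v fzero)) (sum-cong-≗ δ-suc) ⟩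
  0ℤ + ∑[ y < n ] (v (fsuc y) * 𝟙 ⌊ y Fin.≟ x ⌋)                    ≡⟨ +-identityˡ _ ⟩
  ∑[ y < n ] (v (fsuc y) * 𝟙 ⌊ y Fin.≟ x ⌋)                         ≡⟨ ∑-δ (v ∘ fsuc) x ⟩
  v (fsuc x)                                                        ∎
  where
    open ≡-Reasoning
    δ-suc : ∀ y → v (fsuc y) * 𝟙 ⌊ fsuc y Fin.≟ fsuc x ⌋ ≡ v (fsuc y) * 𝟙 ⌊ y Fin.≟ x ⌋
    δ-suc y with y Fin.≟ x
    ... | yes _ = refl
    ... | no  _ = refl

∑-≢0 : ∀ {n} (f : Fin n → ℤ) → ¬ sum f ≡ 0ℤ → ∃ λ i → ¬ f i ≡ 0ℤ
∑-≢0 {zero}  f ∑f≢0 = contradiction refl ∑f≢0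
∑-≢0 {suc n} f ∑f≢0 with f fzero ≟ 0ℤ
... | no  f₀≢0 = fzero , f₀≢0
... | yes f₀≡0 with ∑-≢0 (f ∘ fsuc) (λ ∑≡0 → ∑f≢0 (cong₂ _+_ f₀≡0 ∑≡0))
...   | i , fᵢ≢0 = fsuc i , fᵢ≢0

∑∑-distrib-+ : ∀ {m n} (g h : Fin m → Fin n → ℤ) →
  ∑[ y < m ] ∑[ z < n ] (g y z + h y z) ≡ ∑[ y < m ] ∑[ z < n ] g y z + ∑[ y < m ] ∑[ z < n ] h y z
∑∑-distrib-+ g h = trans (sum-cong-≗ (λ y → ∑-distrib-+ (g y) (h y))) (∑-distrib-+ (sum ∘ g) (sum ∘ h))

𝟙*𝟙≢0 : ∀ b b' → ¬ 𝟙 b * 𝟙 b' ≡ 0ℤ → b ≡ true × b' ≡ true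
𝟙*𝟙≢0 true  true  _   = refl , refl
𝟙*𝟙≢0 true  false ≢0 = contradiction refl ≢0
𝟙*𝟙≢0 false b'    ≢0 = contradiction refl ≢0

𝟙-nonNegative : ∀ b → 0ℤ ≤ 𝟙 b
𝟙-nonNegative true  = +≤+ z≤n
𝟙-nonNegative false = +≤+ z≤n

∑-weights-interchange : ∀ {n} (u v f : Fin n → ℤ) →
  (∀ i j → u i * v j * f j ≡ u i * v j * f i) →
  sum u * ∑[ j < n ] (v j * f j) ≡ sum v * ∑[ i < n ] (u i * f i)
∑-weights-interchange {n} u v f f-const = begin
  sum u * ∑[ j < n ] (v j * f j)              ≡⟨ *-distribʳ-sum (∑[ j < n ] (v j * f j)) u ⟩
  ∑[ i < n ] (u i * ∑[ j < n ] (v j * f j))     ≡⟨ sum-cong-≗ (λ i → *-distribˡ-sum (u i) (λ j → v j * f j)) ⟩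
  ∑[ i < n ] ∑[ j < n ] (u i * (v j * f j))   ≡⟨ sum-cong-≗ (λ i → sum-cong-≗ (λ j → swap-f i j)) ⟩
  ∑[ i < n ] ∑[ j < n ] (v j * (u i * f i))   ≡⟨ ∑-comm (λ i j → v j * (u i * f i)) ⟩
  ∑[ j < n ] ∑[ i < n ] (v j * (u i * f i))   ≡⟨ sum-cong-≗ (λ j → *-distribˡ-sum (v j) (λ i → u i * f i)) ⟨
  ∑[ j < n ] (v j * ∑[ i < n ] (u i * f i))     ≡⟨ *-distribʳ-sum (∑[ i < n ] (u i * f i)) v ⟨
  sum v * ∑[ i < n ] (u i * f i)              ∎
  where
    open ≡-Reasoning
    swap-f : ∀ i j → u i * (v j * f j) ≡ v j * (u i * f i)
    swap-f i j = begin
      u i * (v j * f j)  ≡⟨ *-assoc (u i) (v j) (f j) ⟨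
      u i * v j * f j    ≡⟨ f-const i j ⟩
      u i * v j * f i    ≡⟨ cong (_* f i) (*-comm (u i) (v j)) ⟩
      v j * u i * f i    ≡⟨ *-assoc (v j) (u i) (f i) ⟩
      v j * (u i * f i)  ∎

-- Δ r = E − r for the shift E: this is how A − r acts on the sequences s ↦ ⟨ A^s v , w ⟩.
Δ : ℤ → (ℕ → ℤ) → ℕ → ℤ
Δ r X j = X (suc j) - r * X j

Δ-cong : ∀ r {X Y : ℕ → ℤ} → (∀ s → X s ≡ Y s) → ∀ j → Δ r X j ≡ Δ r Y j
Δ-cong r X≗Y j = cong₂ (λ p q → p - r * q) (X≗Y (suc j)) (X≗Y j)

Δ-scale : ∀ r α (X : ℕ → ℤ) j → Δ r (λ s → α * X s) j ≡ α * Δ r X j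
Δ-scale r α X j = solve r α (X (suc j)) (X j)
  where
    solve : ∀ r α x₁ x₀ → α * x₁ - r * (α * x₀) ≡ α * (x₁ - r * x₀)
    solve = solve-∀

ΔΔ-scale : ∀ r t α (X : ℕ → ℤ) j → Δ r (Δ t (λ s → α * X s)) j ≡ α * Δ r (Δ t X) j
ΔΔ-scale r t α X j = trans (Δ-cong r (Δ-scale t α X) j) (Δ-scale r α (Δ t X) j)

-- The adjacency operator

module AdjacencyOperator {n : ℕ} (G : Graph n) where

  a : Fin n → Fin n → ℤ
  a x y = 𝟙 (adj G x y)

  a-sym : ∀ x y → a x y ≡ a y x
  a-sym x y = cong 𝟙 (Graph.sym G x y)

  V : Set
  V = Vector ℤ n

  infixl 6 _+ᵛ_
  infixr 7 _·ᵛ_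

  _+ᵛ_ : V → V → V
  (u +ᵛ v) i = u i + v i

  _·ᵛ_ : ℤ → V → V
  (α ·ᵛ v) i = α * v i

  A : V → V
  A v x = ∑[ y < n ] (a x y * v y)

  A^_ : ℕ → V → V
  (A^ zero)  v = v
  (A^ suc s) v = A ((A^ s) v)

  ⟨_,_⟩ : V → V → ℤ
  ⟨ u , v ⟩ = ∑[ i < n ] (u i * v i)

  -- Oriented so that e x y is literally walks G 0 y x.
  e : Fin n → V
  e x y = 𝟙 ⌊ y Fin.≟ x ⌋

  A-cong : ∀ {u v} → u ≗ v → A u ≗ A v
  A-cong u≗v x = sum-cong-≗ (λ y → cong (a x y *_) (u≗v y))

  A-+ᵛ : ∀ u v → A (u +ᵛ v) ≗ A u +ᵛ A v
  A-+ᵛ u v x = trans (sum-cong-≗ (λ y → *-distribˡ-+ (a x y) (u y) (v y))) (∑-distrib-+ (λ y → a x y * u y) (λ y → a x y * v y))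

  A-·ᵛ : ∀ α v → A (α ·ᵛ v) ≗ α ·ᵛ A v
  A-·ᵛ α v x = trans (sum-cong-≗ (λ y → x*[α*y]≡α*[x*y] (a x y) α (v y))) (sym (*-distribˡ-sum α (λ y → a x y * v y)))
    where
      x*[α*y]≡α*[x*y] : ∀ x α y → x * (α * y) ≡ α * (x * y)
      x*[α*y]≡α*[x*y] = solve-∀

  ⟨⟩-comm : ∀ u v → ⟨ u , v ⟩ ≡ ⟨ v , u ⟩
  ⟨⟩-comm u v = sum-cong-≗ (λ i → *-comm (u i) (v i))

  ⟨⟩-congʳ : ∀ u {v w} → v ≗ w → ⟨ u , v ⟩ ≡ ⟨ u , w ⟩
  ⟨⟩-congʳ u v≗w = sum-cong-≗ (λ i → cong (u i *_) (v≗w i))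

  ⟨⟩-+ᵛˡ : ∀ u v w → ⟨ u +ᵛ v , w ⟩ ≡ ⟨ u , w ⟩ + ⟨ v , w ⟩
  ⟨⟩-+ᵛˡ u v w = trans (sum-cong-≗ (λ i → *-distribʳ-+ (w i) (u i) (v i))) (∑-distrib-+ (λ i → u i * w i) (λ i → v i * w i))

  ⟨⟩-·ᵛˡ : ∀ α v w → ⟨ α ·ᵛ v , w ⟩ ≡ α * ⟨ v , w ⟩
  ⟨⟩-·ᵛˡ α v w = trans (sum-cong-≗ (λ i → *-assoc α (v i) (w i))) (sym (*-distribˡ-sum α (λ i → v i * w i)))

  A-selfAdjoint : ∀ u v → ⟨ A u , v ⟩ ≡ ⟨ u , A v ⟩
  A-selfAdjoint u v = begin
    ∑[ x < n ] (∑[ y < n ] (a x y * u y) * v x)    ≡⟨ sum-cong-≗ (λ x → *-distribʳ-sum (v x) (λ y → a x y * u y)) ⟩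
    ∑[ x < n ] ∑[ y < n ] (a x y * u y * v x)      ≡⟨ ∑-comm (λ x y → a x y * u y * v x) ⟩
    ∑[ y < n ] ∑[ x < n ] (a x y * u y * v x)      ≡⟨ sum-cong-≗ (λ y → sum-cong-≗ (λ x → reassociate y x)) ⟩
    ∑[ y < n ] ∑[ x < n ] (u y * (a y x * v x))    ≡⟨ sum-cong-≗ (λ y → *-distribˡ-sum (u y) (λ x → a y x * v x)) ⟨
    ∑[ y < n ] (u y * ∑[ x < n ] (a y x * v x))    ∎
    where
      open ≡-Reasoning
      reassociate : ∀ y x → a x y * u y * v x ≡ u y * (a y x * v x)
      reassociate y x = trans (cong (λ t → t * u y * v x) (a-sym x y)) (solve (a y x) (u y) (v x))
        where solve : ∀ p q r → p * q * r ≡ q * (p * r)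
              solve = solve-∀

  A^-comm : ∀ j v → (A^ j) (A v) ≗ A ((A^ j) v)
  A^-comm zero    v x = refl
  A^-comm (suc j) v   = A-cong (A^-comm j v)

  A^-selfAdjoint : ∀ j u v → ⟨ (A^ j) u , v ⟩ ≡ ⟨ u , (A^ j) v ⟩
  A^-selfAdjoint zero    u v = refl
  A^-selfAdjoint (suc j) u v = begin
    ⟨ A ((A^ j) u) , v ⟩    ≡⟨ A-selfAdjoint ((A^ j) u) v ⟩
    ⟨ (A^ j) u , A v ⟩      ≡⟨ A^-selfAdjoint j u (A v) ⟩
    ⟨ u , (A^ j) (A v) ⟩    ≡⟨ ⟨⟩-congʳ u (A^-comm j v) ⟩
    ⟨ u , A ((A^ j) v) ⟩    ∎
    where open ≡-Reasoning

  ⟨⟩-e : ∀ v x → ⟨ v , e x ⟩ ≡ v x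
  ⟨⟩-e = ∑-δ

  A-e : ∀ x y → A (e x) y ≡ a y x
  A-e x y = ∑-δ (a y) x

  +walks-suc : ∀ ℓ x y → + walks G (suc ℓ) x y ≡ ∑[ z < n ] (a x z * + walks G ℓ z y)
  +walks-suc ℓ x y = trans (+sum-map-allFin (λ z → if adj G x z then walks G ℓ z y else 0))
                           (sum-cong-≗ (λ z → +if (adj G x z) (walks G ℓ z y)))
    where
      +if : ∀ b w → + (if b then w else 0) ≡ 𝟙 b * + w
      +if true  w = sym (*-identityˡ (+ w))
      +if false w = refl

  A^-e : ∀ s x y → (A^ s) (e x) y ≡ + walks G s y x
  A^-e zero    x y = refl
  A^-e (suc s) x y = trans (A-cong (λ z → A^-e s x z) y) (sym (+walks-suc s y x))

  ⟨v,v⟩≡0⇒v≗0 : ∀ v → ⟨ v , v ⟩ ≡ 0ℤ → ∀ i → v i ≡ 0ℤ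
  ⟨v,v⟩≡0⇒v≗0 v ⟨v,v⟩≡0 i = i*i≡0⇒i≡0 (v i) (∑-nonNegative-≡0 (λ j → 0≤i*i (v j)) ⟨v,v⟩≡0 i)

  [A-_] : ℤ → V → V
  [A- r ] v = A v +ᵛ (- r) ·ᵛ v

  [A-]-cong : ∀ r {u v} → u ≗ v → [A- r ] u ≗ [A- r ] v
  [A-]-cong r u≗v x = cong₂ (λ p q → p + - r * q) (A-cong u≗v x) (u≗v x)

  ⟨A^,[A-]⟩ : ∀ r v w j → ⟨ (A^ j) v , [A- r ] w ⟩ ≡ Δ r (λ s → ⟨ (A^ s) v , w ⟩) j
  ⟨A^,[A-]⟩ r v w j = begin
    ⟨ (A^ j) v , A w +ᵛ (- r) ·ᵛ w ⟩                 ≡⟨ ⟨⟩-comm ((A^ j) v) (A w +ᵛ (- r) ·ᵛ w) ⟩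
    ⟨ A w +ᵛ (- r) ·ᵛ w , (A^ j) v ⟩                 ≡⟨ ⟨⟩-+ᵛˡ (A w) _ _ ⟩
    ⟨ A w , (A^ j) v ⟩ + ⟨ (- r) ·ᵛ w , (A^ j) v ⟩  ≡⟨ cong₂ _+_ (A-selfAdjoint w _) (⟨⟩-·ᵛˡ (- r) w _) ⟩
    ⟨ w , (A^ suc j) v ⟩ + (- r) * ⟨ w , (A^ j) v ⟩ ≡⟨ cong₂ (λ p q → p + (- r) * q) (⟨⟩-comm w _) (⟨⟩-comm w _) ⟩
    ⟨ (A^ suc j) v , w ⟩ + (- r) * ⟨ (A^ j) v , w ⟩ ≡⟨ cong (_+_ ⟨ (A^ suc j) v , w ⟩) (neg-distribˡ-* r _) ⟨
    Δ r (λ s → ⟨ (A^ s) v , w ⟩) j                   ∎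
    where open ≡-Reasoning

  ⟨A^,[A-][A-]⟩ : ∀ r t v w j → ⟨ (A^ j) v , [A- r ] ([A- t ] w) ⟩ ≡ Δ r (Δ t (λ s → ⟨ (A^ s) v , w ⟩)) j
  ⟨A^,[A-][A-]⟩ r t v w j = trans (⟨A^,[A-]⟩ r v ([A- t ] w) j) (Δ-cong r (⟨A^,[A-]⟩ t v w) j)

  infix 4 _⊥𝒦_

  record _⊥𝒦_ (v w : V) : Set where
    constructor ⊥𝒦-intro
    field ⊥A^ : ∀ j → ⟨ v , (A^ j) w ⟩ ≡ 0ℤ

  open _⊥𝒦_

  ⊥𝒦-A : ∀ {v w} → v ⊥𝒦 w → A v ⊥𝒦 w
  ⊥𝒦-A {v} {w} v⊥w = ⊥𝒦-intro λ j → trans (A-selfAdjoint v ((A^ j) w)) (⊥A^ v⊥w (suc j))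

  ⊥𝒦-+ᵛ : ∀ {u v w} → u ⊥𝒦 w → v ⊥𝒦 w → u +ᵛ v ⊥𝒦 w
  ⊥𝒦-+ᵛ {u} {v} {w} u⊥w v⊥w = ⊥𝒦-intro λ j → trans (⟨⟩-+ᵛˡ u v ((A^ j) w)) (cong₂ _+_ (⊥A^ u⊥w j) (⊥A^ v⊥w j))

  ⊥𝒦-·ᵛ : ∀ α {v w} → v ⊥𝒦 w → α ·ᵛ v ⊥𝒦 w
  ⊥𝒦-·ᵛ α {v} {w} v⊥w = ⊥𝒦-intro λ j → trans (⟨⟩-·ᵛˡ α v ((A^ j) w)) (trans (cong (α *_) (⊥A^ v⊥w j)) (*-zeroʳ α))

  ⊥𝒦-[A-] : ∀ r {v w} → v ⊥𝒦 w → [A- r ] v ⊥𝒦 w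
  ⊥𝒦-[A-] r v⊥w = ⊥𝒦-+ᵛ (⊥𝒦-A v⊥w) (⊥𝒦-·ᵛ (- r) v⊥w)

  ⊥𝒦-self : ∀ {v} → v ⊥𝒦 v → ∀ i → v i ≡ 0ℤ
  ⊥𝒦-self {v} v⊥v = ⟨v,v⟩≡0⇒v≗0 v (⊥A^ v⊥v 0)

  module Regular {k : ℤ} (degree : ∀ x → sum (a x) ≡ k) where

    [A-k]-const : ∀ α → [A- k ] (λ _ → α) ≗ λ _ → 0ℤ
    [A-k]-const α x = begin
      ∑[ y < n ] (a x y * α) + - k * α   ≡⟨ cong (_+ - k * α) (*-distribʳ-sum α (a x)) ⟨
      sum (a x) * α + - k * α            ≡⟨ cong (λ d → d * α + - k * α) (degree x) ⟩
      k * α + - k * α                    ≡⟨ cancel k α ⟩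
      0ℤ                                 ∎
      where
        open ≡-Reasoning
        cancel : ∀ k α → k * α + - k * α ≡ 0ℤ
        cancel = solve-∀

    laplacian-form : ∀ f →
      ∑[ y < n ] ∑[ z < n ] (a y z * ((f y - f z) * (f y - f z))) + + 2 * ⟨ f , A f ⟩ ≡ + 2 * (k * ⟨ f , f ⟩)
    laplacian-form f = begin
      ∑∑ (λ y z → a y z * ((f y - f z) * (f y - f z))) + + 2 * ⟨ f , A f ⟩
        ≡⟨ cong (_+_ (∑∑ (λ y z → a y z * ((f y - f z) * (f y - f z))))) cross-terms ⟩
      ∑∑ (λ y z → a y z * ((f y - f z) * (f y - f z))) + ∑∑ (λ y z → + 2 * f y * (a y z * f z))
        ≡⟨ ∑∑-distrib-+ (λ y z → a y z * ((f y - f z) * (f y - f z))) (λ y z → + 2 * f y * (a y z * f z)) ⟨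
      ∑∑ (λ y z → a y z * ((f y - f z) * (f y - f z)) + + 2 * f y * (a y z * f z))
        ≡⟨ sum-cong-≗ (λ y → sum-cong-≗ (λ z → expand (a y z) (f y) (f z))) ⟩
      ∑∑ (λ y z → a y z * (f y * f y) + a y z * (f z * f z))
        ≡⟨ ∑∑-distrib-+ (λ y z → a y z * (f y * f y)) (λ y z → a y z * (f z * f z)) ⟩
      ∑∑ (λ y z → a y z * (f y * f y)) + ∑∑ (λ y z → a y z * (f z * f z))
        ≡⟨ cong₂ _+_ rows columns ⟩
      k * ⟨ f , f ⟩ + k * ⟨ f , f ⟩
        ≡⟨ double (k * ⟨ f , f ⟩) ⟩
      + 2 * (k * ⟨ f , f ⟩)   ∎
      where
        open ≡-Reasoning
        ∑∑ : (Fin n → Fin n → ℤ) → ℤ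
        ∑∑ g = ∑[ y < n ] ∑[ z < n ] g y z
        expand : ∀ a p q → a * ((p - q) * (p - q)) + + 2 * p * (a * q) ≡ a * (p * p) + a * (q * q)
        expand = solve-∀
        double : ∀ x → x + x ≡ + 2 * x
        double = solve-∀
        cross-terms : + 2 * ⟨ f , A f ⟩ ≡ ∑∑ (λ y z → + 2 * f y * (a y z * f z))
        cross-terms = trans (*-distribˡ-sum (+ 2) (λ y → f y * A f y))
          (sum-cong-≗ (λ y → trans (sym (*-assoc (+ 2) (f y) (A f y))) (*-distribˡ-sum (+ 2 * f y) (λ z → a y z * f z))))
        rows : ∑∑ (λ y z → a y z * (f y * f y)) ≡ k * ⟨ f , f ⟩
        rows = trans (sum-cong-≗ (λ y → trans (sym (*-distribʳ-sum (f y * f y) (a y))) (cong (_* (f y * f y)) (degree y))))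
                     (sym (*-distribˡ-sum k (λ y → f y * f y)))
        columns : ∑∑ (λ y z → a y z * (f z * f z)) ≡ k * ⟨ f , f ⟩
        columns = trans (∑-comm (λ y z → a y z * (f z * f z)))
                        (trans (sum-cong-≗ (λ z → sum-cong-≗ (λ y → cong (_* (f z * f z)) (a-sym y z)))) rows)

    eigenvector-constant-on-edges : ∀ f → A f ≗ k ·ᵛ f → ∀ y z → adj G y z ≡ true → f y ≡ f z
    eigenvector-constant-on-edges f Af≗kf y z yz∈E = i-j≡0⇒i≡j (f y) (f z) (i*i≡0⇒i≡0 (f y - f z) square≡0)
      where
        term : Fin n → Fin n → ℤ
        term y z = a y z * ((f y - f z) * (f y - f z))
        term-nonNegative : ∀ y z → 0ℤ ≤ term y z
        term-nonNegative y z with adj G y z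
        ... | true  = subst (0ℤ ≤_) (sym (*-identityˡ _)) (0≤i*i (f y - f z))
        ... | false = +≤+ z≤n
        ⟨f,Af⟩ : ⟨ f , A f ⟩ ≡ k * ⟨ f , f ⟩
        ⟨f,Af⟩ = trans (⟨⟩-congʳ f Af≗kf) (trans (⟨⟩-comm f (k ·ᵛ f)) (⟨⟩-·ᵛˡ k f f))
        cancel : ∀ Q T → Q + T ≡ T → Q ≡ 0ℤ
        cancel Q T eq = trans (solve Q T) (trans (cong (_- T) eq) (+-inverseʳ T))
          where solve : ∀ Q T → Q ≡ Q + T - T
                solve = solve-∀
        ∑∑term≡0 : ∑[ y < n ] ∑[ z < n ] term y z ≡ 0ℤ
        ∑∑term≡0 = cancel (∑[ y < n ] ∑[ z < n ] term y z) (+ 2 * (k * ⟨ f , f ⟩))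
          (trans (cong (λ t → ∑[ y < n ] ∑[ z < n ] term y z + + 2 * t) (sym ⟨f,Af⟩)) (laplacian-form f))
        square≡0 : (f y - f z) * (f y - f z) ≡ 0ℤ
        square≡0 = begin
          (f y - f z) * (f y - f z)             ≡⟨ *-identityˡ _ ⟨
          𝟙 true * ((f y - f z) * (f y - f z))  ≡⟨ cong (λ b → 𝟙 b * ((f y - f z) * (f y - f z))) yz∈E ⟨
          term y z                              ≡⟨ ∑-nonNegative-≡0 (term-nonNegative y) row≡0 z ⟩
          0ℤ                                    ∎
          where
            open ≡-Reasoning
            row≡0 : ∑[ z < n ] term y z ≡ 0ℤ
            row≡0 = ∑-nonNegative-≡0 (λ y → ∑-nonNegative (term-nonNegative y)) ∑∑term≡0 y

  walks-2≡commonNbrs : ∀ x y → walks G 2 x y ≡ commonNbrs G x y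
  walks-2≡commonNbrs x y = +-injective (begin
    + walks G 2 x y                              ≡⟨ A^-e 2 y x ⟨
    ∑[ z < n ] (a x z * A (e y) z)               ≡⟨ sum-cong-≗ (λ z → cong (a x z *_) (trans (A-e y z) (a-sym z y))) ⟩
    ∑[ z < n ] (a x z * a y z)                   ≡⟨ sum-cong-≗ (λ z → 𝟙-∧ (adj G x z) (adj G y z)) ⟩
    ∑[ z < n ] 𝟙 (adj G x z ∧ adj G y z)         ≡⟨ +count (λ z → adj G x z ∧ adj G y z) ⟨
    + commonNbrs G x y                           ∎)
    where
      open ≡-Reasoning
      𝟙-∧ : ∀ b b' → 𝟙 b * 𝟙 b' ≡ 𝟙 (b ∧ b')
      𝟙-∧ true  b' = *-identityˡ (𝟙 b')
      𝟙-∧ false b' = refl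

  degree≡walks-2 : ∀ x → count (adj G x) ≡ walks G 2 x x
  degree≡walks-2 x = +-injective (begin
    + count (adj G x)                         ≡⟨ +count (adj G x) ⟩
    ∑[ z < n ] 𝟙 (adj G x z)                  ≡⟨ sum-cong-≗ (λ z → cong 𝟙 (∧-idem (adj G x z))) ⟨
    ∑[ z < n ] 𝟙 (adj G x z ∧ adj G x z)      ≡⟨ +count (λ z → adj G x z ∧ adj G x z) ⟨
    + commonNbrs G x x                        ≡⟨ cong +_ (walks-2≡commonNbrs x x) ⟨
    + walks G 2 x x                           ∎)
    where open ≡-Reasoning

  Dist-refl : ∀ x → Dist G x x 0
  Dist-refl x = walk₀ , λ _ ()
    where
      walk₀ : 1 ℕ.≤ walks G 0 x x
      walk₀ with x Fin.≟ x
      ... | yes _  = s≤s z≤n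
      ... | no x≢x = contradiction refl x≢x

  Dist-adj : ∀ {x y} → adj G x y ≡ true → Dist G x y 1
  Dist-adj {x} {y} xy∈E = subst (1 ℕ.≤_) (sym walks₁≡1) (s≤s z≤n) , λ { 0 _ → walks₀≡0 ; (suc _) (s≤s ()) }
    where
      walks₁≡1 : walks G 1 x y ≡ 1
      walks₁≡1 = +-injective (trans (sym (A^-e 1 y x)) (trans (A-e y x) (cong 𝟙 xy∈E)))
      walks₀≡0 : walks G 0 x y ≡ 0
      walks₀≡0 with x Fin.≟ y
      ... | no _     = refl
      ... | yes refl = contradiction (trans (sym xy∈E) (irrefl G x)) (λ ())

  module WalkRegular₁ (WR : WalkRegular 1 G) where

    walks-diagonal : ∀ ℓ x y → walks G ℓ x x ≡ walks G ℓ y y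
    walks-diagonal ℓ x y = WR 0 z≤n x x y y (Dist-refl x) (Dist-refl y) ℓ

    walks-edge : ∀ ℓ {x y x' y'} → adj G x y ≡ true → adj G x' y' ≡ true → walks G ℓ x y ≡ walks G ℓ x' y'
    walks-edge ℓ {x} {y} {x'} {y'} xy∈E x'y'∈E = WR 1 ≤-refl x y x' y' (Dist-adj xy∈E) (Dist-adj x'y'∈E) ℓ

    A^e-neighbours : ∀ s {x i j} → adj G x i ≡ true → adj G x j ≡ true → (A^ s) (e x) i ≡ (A^ s) (e x) j
    A^e-neighbours s {x} {i} {j} xi∈E xj∈E = begin
      (A^ s) (e x) i     ≡⟨ A^-e s x i ⟩
      + walks G s i x    ≡⟨ cong +_ (walks-edge s (trans (Graph.sym G i x) xi∈E) (trans (Graph.sym G j x) xj∈E)) ⟩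
      + walks G s j x    ≡⟨ A^-e s x j ⟨
      (A^ s) (e x) j     ∎
      where open ≡-Reasoning

    commonNbrs-adjacent-constant : ∀ {x y x' y'} → adj G x y ≡ true → adj G x' y' ≡ true →
      commonNbrs G x y ≡ commonNbrs G x' y'
    commonNbrs-adjacent-constant {x} {y} {x'} {y'} xy∈E x'y'∈E =
      trans (sym (walks-2≡commonNbrs x y)) (trans (walks-edge 2 xy∈E x'y'∈E) (walks-2≡commonNbrs x' y'))

-- A 1-walk-regular graph with a regular clique

module RegularClique {n : ℕ} {G : Graph n} (WR : WalkRegular 1 G)
  {C : Fin n → Bool} (C-clique : IsClique G C) {m : ℕ} (1≤m : 1 ℕ.≤ m)
  (C-regular : ∀ x → C x ≡ false → count (λ z → C z ∧ adj G x z) ≡ m) (x₀ : Fin n) where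

  open AdjacencyOperator G
  open WalkRegular₁ WR

  -- x₀ is an arbitrary base point: D s is the common diagonal entry of A^s.
  D : ℕ → ℤ
  D s = + walks G s x₀ x₀

  k : ℤ
  k = D 2

  degree : ∀ x → sum (a x) ≡ k
  degree x = trans (sym (+count (adj G x))) (cong +_ (trans (degree≡walks-2 x) (walks-diagonal 2 x x₀)))

  open Regular degree

  χ : V
  χ x = 𝟙 (C x)

  c : ℤ
  c = sum χ

  θ : ℤ
  θ = c - 1ℤ - + m

  χ-split : ∀ {x} → C x ≡ true → ∀ y → χ y ≡ e x y + a x y * χ y
  χ-split {x} x∈C y with y Fin.≟ x
  ... | yes refl = trans (cong 𝟙 x∈C) (cong (λ b → + 1 + 𝟙 b * χ y) (sym (irrefl G y)))
  ... | no  y≢x with C y in y∈C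
  ...   | true  = trans (cong 𝟙 (sym (C-clique x y x∈C y∈C (y≢x ∘ sym))))
                          (sym (trans (+-identityˡ _) (*-identityʳ (a x y))))
  ...   | false = sym (trans (+-identityˡ _) (*-zeroʳ (a x y)))

  Aχ-inside : ∀ {x} → C x ≡ true → A χ x ≡ c - 1ℤ
  Aχ-inside {x} x∈C = sym (begin
    c - 1ℤ                                           ≡⟨ cong (_- 1ℤ) (sum-cong-≗ (χ-split x∈C)) ⟩
    ∑[ y < n ] (e x y + a x y * χ y) - 1ℤ            ≡⟨ cong (_- 1ℤ) (∑-distrib-+ (e x) (λ y → a x y * χ y)) ⟩
    sum (e x) + A χ x - 1ℤ                           ≡⟨ cong (λ t → t + A χ x - 1ℤ) ∑e≡1 ⟩
    1ℤ + A χ x - 1ℤ                                  ≡⟨ cancel (A χ x) ⟩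
    A χ x                                            ∎)
    where
      open ≡-Reasoning
      ∑e≡1 : sum (e x) ≡ 1ℤ
      ∑e≡1 = trans (sum-cong-≗ (λ y → sym (*-identityˡ (e x y)))) (∑-δ (λ _ → 1ℤ) x)
      cancel : ∀ t → 1ℤ + t - 1ℤ ≡ t
      cancel = solve-∀

  Aχ-outside : ∀ {x} → C x ≡ false → A χ x ≡ + m
  Aχ-outside {x} x∉C = begin
    ∑[ y < n ] (a x y * χ y)             ≡⟨ sum-cong-≗ (λ y → 𝟙-∧ (adj G x y) (C y)) ⟩
    ∑[ y < n ] 𝟙 (C y ∧ adj G x y)       ≡⟨ +count (λ y → C y ∧ adj G x y) ⟨
    + count (λ y → C y ∧ adj G x y)      ≡⟨ cong +_ (C-regular x x∉C) ⟩
    + m                                  ∎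
    where
      open ≡-Reasoning
      𝟙-∧ : ∀ b b' → 𝟙 b * 𝟙 b' ≡ 𝟙 (b' ∧ b)
      𝟙-∧ true  true  = refl
      𝟙-∧ true  false = refl
      𝟙-∧ false b'    = sym (cong 𝟙 (∧-zeroʳ b'))

  [A-θ]χ≗m : [A- θ ] χ ≗ λ _ → + m
  [A-θ]χ≗m x with C x in x∈C
  ... | true  = trans (cong (_+ - θ * 1ℤ) (Aχ-inside x∈C)) (cancel c (+ m))
    where cancel : ∀ c m → c - 1ℤ + - (c - 1ℤ - m) * 1ℤ ≡ m
          cancel = solve-∀
  ... | false = trans (cong (_+ - θ * 0ℤ) (Aχ-outside x∈C)) (cancel θ (+ m))
    where cancel : ∀ θ m → m + - θ * 0ℤ ≡ m
          cancel = solve-∀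

  [A-k][A-θ]χ≗0 : [A- k ] ([A- θ ] χ) ≗ λ _ → 0ℤ
  [A-k][A-θ]χ≗0 x = trans ([A-]-cong k [A-θ]χ≗m x) ([A-k]-const (+ m) x)

  m≢0 : ¬ + m ≡ 0ℤ
  m≢0 = positive 1≤m
    where
      positive : ∀ {m} → 1 ℕ.≤ m → ¬ + m ≡ 0ℤ
      positive (s≤s _) ()

  C-dominating : ∀ y → C y ≡ true ⊎ ∃ λ z → C z ≡ true × adj G y z ≡ true
  C-dominating y with C y in y∈C
  ... | true  = inj₁ refl
  ... | false with ∑-≢0 (λ z → a y z * χ z) (λ ∑≡0 → m≢0 (trans (sym (Aχ-outside y∈C)) ∑≡0))
  ...   | z , ≢0 with 𝟙*𝟙≢0 (adj G y z) (C z) ≢0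
  ...     | yz∈E , z∈C = inj₂ (z , z∈C , yz∈E)

  constant-on-edges⇒constant : ∀ (f : V) → (∀ y z → adj G y z ≡ true → f y ≡ f z) → ∀ y z → f y ≡ f z
  constant-on-edges⇒constant f f-edge y z = through-C (C-representative y) (C-representative z)
    where
      C-representative : ∀ y → ∃ λ r → C r ≡ true × f y ≡ f r
      C-representative y with C-dominating y
      ... | inj₁ y∈C              = y , y∈C , refl
      ... | inj₂ (r , r∈C , yr∈E) = r , r∈C , f-edge y r yr∈E
      constant-on-C : ∀ {r r'} → C r ≡ true → C r' ≡ true → f r ≡ f r'
      constant-on-C {r} {r'} r∈C r'∈C with r Fin.≟ r'
      ... | yes refl = refl
      ... | no  r≢r' = f-edge r r' (C-clique r r' r∈C r'∈C r≢r')
      through-C : (∃ λ r → C r ≡ true × f y ≡ f r) → (∃ λ r → C r ≡ true × f z ≡ f r) → f y ≡ f z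
      through-C (r , r∈C , fy≡fr) (r' , r'∈C , fz≡fr') = trans fy≡fr (trans (constant-on-C r∈C r'∈C) (sym fz≡fr'))

  C-nonempty : ∃ λ z → C z ≡ true
  C-nonempty with C-dominating x₀
  ... | inj₁ x₀∈C           = x₀ , x₀∈C
  ... | inj₂ (z , z∈C , _) = z , z∈C

  c≢0 : ¬ c ≡ 0ℤ
  c≢0 c≡0 with C-nonempty
  ... | z , z∈C = 𝟙≢0 (trans (cong 𝟙 (sym z∈C)) (∑-nonNegative-≡0 (𝟙-nonNegative ∘ C) c≡0 z))
    where
      𝟙≢0 : ¬ 𝟙 true ≡ 0ℤ
      𝟙≢0 ()

  A^e-diagonal : ∀ s x → (A^ s) (e x) x ≡ D s
  A^e-diagonal s x = trans (A^-e s x x) (cong +_ (walks-diagonal s x x₀))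

  K : ℕ → ℤ
  K s = k * D s + (c - 1ℤ) * D (suc s)

  -- A^s e_x takes one value w on the neighbours of x, so ⟨ χ , A^s e_x ⟩ = D s + (c − 1) w
  -- while D (1 + s) = k w.
  k⟨χ,A^e⟩≡K : ∀ s {x} → C x ≡ true → k * ⟨ χ , (A^ s) (e x) ⟩ ≡ K s
  k⟨χ,A^e⟩≡K s {x} x∈C = begin
    k * ⟨ χ , w ⟩                                         ≡⟨ cong (k *_) (sum-cong-≗ (λ y → cong (_* w y) (χ-split x∈C y))) ⟩
    k * ∑[ y < n ] ((e x y + a x y * χ y) * w y)
      ≡⟨ cong (k *_) (trans (sum-cong-≗ (λ y → *-distribʳ-+ (w y) (e x y) (a x y * χ y)))
                            (∑-distrib-+ (λ y → e x y * w y) (λ y → a x y * χ y * w y))) ⟩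
    k * (⟨ e x , w ⟩ + B)
      ≡⟨ cong (λ t → k * (t + B)) (trans (⟨⟩-comm (e x) w) (trans (⟨⟩-e w x) (A^e-diagonal s x))) ⟩
    k * (D s + B)                                         ≡⟨ *-distribˡ-+ k (D s) B ⟩
    k * D s + k * B                                       ≡⟨ cong (_+_ (k * D s)) neighbours-in-C ⟨
    K s                                                   ∎
    where
      open ≡-Reasoning
      w : V
      w = (A^ s) (e x)
      B : ℤ
      B = ∑[ y < n ] (a x y * χ y * w y)
      w-constant : ∀ i j → 𝟙 (adj G x i) * χ i * 𝟙 (adj G x j) * w j ≡ 𝟙 (adj G x i) * χ i * 𝟙 (adj G x j) * w i
      w-constant i j with adj G x i in xi∈E | adj G x j in xj∈E
      ... | true  | true  = cong (𝟙 true * χ i * 𝟙 true *_) (A^e-neighbours s xj∈E xi∈E)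
      ... | true  | false = killed (𝟙 true * χ i) (w j) (w i)
        where killed : ∀ t p q → t * 0ℤ * p ≡ t * 0ℤ * q
              killed = solve-∀
      ... | false | _     = refl
      neighbours-in-C : (c - 1ℤ) * D (suc s) ≡ k * B
      neighbours-in-C = begin
        (c - 1ℤ) * D (suc s)                          ≡⟨ cong₂ _*_ (Aχ-inside x∈C) (A^e-diagonal (suc s) x) ⟨
        A χ x * A w x                                 ≡⟨ ∑-weights-interchange (λ y → a x y * χ y) (a x) w w-constant ⟩
        sum (a x) * B                                 ≡⟨ cong (_* B) (degree x) ⟩
        k * B                                         ∎

  Q : ℕ → ℤ
  Q s = ⟨ (A^ s) χ , χ ⟩

  kQ≡cK : ∀ s → k * Q s ≡ c * K s
  kQ≡cK s = begin
    k * ∑[ x < n ] ((A^ s) χ x * χ x)      ≡⟨ *-distribˡ-sum k (λ x → (A^ s) χ x * χ x) ⟩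
    ∑[ x < n ] (k * ((A^ s) χ x * χ x))    ≡⟨ sum-cong-≗ (λ x → only-C x (C x) refl) ⟩
    ∑[ x < n ] (χ x * K s)                 ≡⟨ *-distribʳ-sum (K s) χ ⟨
    c * K s                                ∎
    where
      open ≡-Reasoning
      only-C : ∀ x b → C x ≡ b → k * ((A^ s) χ x * 𝟙 b) ≡ 𝟙 b * K s
      only-C x true  x∈C = begin
        k * ((A^ s) χ x * 1ℤ)              ≡⟨ cong (k *_) (*-identityʳ _) ⟩
        k * (A^ s) χ x                     ≡⟨ cong (k *_) (trans (sym (⟨⟩-e ((A^ s) χ) x)) (A^-selfAdjoint s χ (e x))) ⟩
        k * ⟨ χ , (A^ s) (e x) ⟩           ≡⟨ k⟨χ,A^e⟩≡K s x∈C ⟩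
        K s                                ≡⟨ *-identityˡ (K s) ⟨
        1ℤ * K s                           ∎
      only-C x false _ = trans (cong (k *_) (*-zeroʳ ((A^ s) χ x))) (*-zeroʳ k)

  ΔΔQ≡0 : ∀ j → Δ k (Δ θ Q) j ≡ 0ℤ
  ΔΔQ≡0 j = begin
    Δ k (Δ θ Q) j                             ≡⟨ ⟨A^,[A-][A-]⟩ k θ χ χ j ⟨
    ⟨ (A^ j) χ , [A- k ] ([A- θ ] χ) ⟩        ≡⟨ ⟨⟩-congʳ ((A^ j) χ) [A-k][A-θ]χ≗0 ⟩
    ∑[ y < n ] ((A^ j) χ y * 0ℤ)              ≡⟨ ∑-zero (λ y → *-zeroʳ ((A^ j) χ y)) ⟩
    0ℤ                                        ∎
    where open ≡-Reasoning

  ΔΔK≡0 : ∀ j → Δ k (Δ θ K) j ≡ 0ℤ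
  ΔΔK≡0 j = cancel c≢0 (begin
    c * Δ k (Δ θ K) j                         ≡⟨ ΔΔ-scale k θ c K j ⟨
    Δ k (Δ θ (λ s → c * K s)) j               ≡⟨ Δ-cong k (Δ-cong θ (λ s → sym (kQ≡cK s))) j ⟩
    Δ k (Δ θ (λ s → k * Q s)) j               ≡⟨ ΔΔ-scale k θ k Q j ⟩
    k * Δ k (Δ θ Q) j                         ≡⟨ cong (k *_) (ΔΔQ≡0 j) ⟩
    k * 0ℤ                                    ≡⟨ *-zeroʳ k ⟩
    0ℤ                                        ∎)
    where
      open ≡-Reasoning
      cancel : ∀ {c x} → ¬ c ≡ 0ℤ → c * x ≡ 0ℤ → x ≡ 0ℤ
      cancel {c} c≢0 cx≡0 with i*j≡0⇒i≡0∨j≡0 c cx≡0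
      ... | inj₁ c≡0 = contradiction c≡0 c≢0
      ... | inj₂ x≡0 = x≡0

  u : Fin n → V
  u x = k ·ᵛ e x +ᵛ (c - 1ℤ) ·ᵛ A (e x)

  ⟨A^e,u⟩≡K : ∀ x s → ⟨ (A^ s) (e x) , u x ⟩ ≡ K s
  ⟨A^e,u⟩≡K x s = begin
    ⟨ w , k ·ᵛ e x +ᵛ (c - 1ℤ) ·ᵛ A (e x) ⟩              ≡⟨ ⟨⟩-comm w (u x) ⟩
    ⟨ k ·ᵛ e x +ᵛ (c - 1ℤ) ·ᵛ A (e x) , w ⟩              ≡⟨ ⟨⟩-+ᵛˡ (k ·ᵛ e x) ((c - 1ℤ) ·ᵛ A (e x)) w ⟩
    ⟨ k ·ᵛ e x , w ⟩ + ⟨ (c - 1ℤ) ·ᵛ A (e x) , w ⟩       ≡⟨ cong₂ _+_ (⟨⟩-·ᵛˡ k (e x) w) (⟨⟩-·ᵛˡ (c - 1ℤ) (A (e x)) w) ⟩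
    k * ⟨ e x , w ⟩ + (c - 1ℤ) * ⟨ A (e x) , w ⟩         ≡⟨ cong (λ t → k * ⟨ e x , w ⟩ + (c - 1ℤ) * t) (A-selfAdjoint (e x) w) ⟩
    k * ⟨ e x , w ⟩ + (c - 1ℤ) * ⟨ e x , A w ⟩           ≡⟨ cong₂ (λ p q → k * p + (c - 1ℤ) * q) (diagonal s) (diagonal (suc s)) ⟩
    K s                                                  ∎
    where
      open ≡-Reasoning
      w : V
      w = (A^ s) (e x)
      diagonal : ∀ s → ⟨ e x , (A^ s) (e x) ⟩ ≡ D s
      diagonal s = trans (⟨⟩-comm (e x) ((A^ s) (e x))) (trans (⟨⟩-e ((A^ s) (e x)) x) (A^e-diagonal s x))

  f : Fin n → V
  f x = [A- θ ] (u x)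

  [A-k]f≗0 : ∀ x → [A- k ] (f x) ≗ λ _ → 0ℤ
  [A-k]f≗0 x = ⊥𝒦-self g⊥g
    where
      g : V
      g = [A- k ] (f x)
      e⊥g : e x ⊥𝒦 g
      e⊥g = ⊥𝒦-intro λ j → begin
        ⟨ e x , (A^ j) g ⟩                                 ≡⟨ A^-selfAdjoint j (e x) g ⟨
        ⟨ (A^ j) (e x) , g ⟩                               ≡⟨ ⟨A^,[A-][A-]⟩ k θ (e x) (u x) j ⟩
        Δ k (Δ θ (λ s → ⟨ (A^ s) (e x) , u x ⟩)) j         ≡⟨ Δ-cong k (Δ-cong θ (⟨A^e,u⟩≡K x)) j ⟩
        Δ k (Δ θ K) j                                      ≡⟨ ΔΔK≡0 j ⟩
        0ℤ                                                 ∎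
        where open ≡-Reasoning
      g⊥g : g ⊥𝒦 g
      g⊥g = ⊥𝒦-[A-] k (⊥𝒦-[A-] θ (⊥𝒦-+ᵛ (⊥𝒦-·ᵛ k e⊥g) (⊥𝒦-·ᵛ (c - 1ℤ) (⊥𝒦-A e⊥g))))

  f-eigenvector : ∀ x → A (f x) ≗ k ·ᵛ f x
  f-eigenvector x y = trans (solve (A (f x) y) k (f x y)) (trans (cong (_+ k * f x y) ([A-k]f≗0 x y)) (+-identityˡ _))
    where
      solve : ∀ p k q → p ≡ (p + - k * q) + k * q
      solve = solve-∀

  f-value : ∀ x y → f x y ≡ k * a y x + (c - 1ℤ) * (A^ 2) (e x) y + - θ * (k * e x y + (c - 1ℤ) * a y x)
  f-value x y = cong₂ (λ p q → p + - θ * q)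
    (trans (A-+ᵛ (k ·ᵛ e x) ((c - 1ℤ) ·ᵛ A (e x)) y) (cong₂ _+_ (trans (A-·ᵛ k (e x) y) (cong (k *_) (A-e x y)))
                                                                (A-·ᵛ (c - 1ℤ) (A (e x)) y)))
    (cong (λ t → k * e x y + (c - 1ℤ) * t) (A-e x y))

  f-nonadjacent : ∀ x y → ¬ y ≡ x → adj G y x ≡ false → f x y ≡ (c - 1ℤ) * + commonNbrs G y x
  f-nonadjacent x y y≢x yx∉E = begin
    f x y                                                                   ≡⟨ f-value x y ⟩
    k * a y x + (c - 1ℤ) * (A^ 2) (e x) y + - θ * (k * e x y + (c - 1ℤ) * a y x)
      ≡⟨ cong₂ (λ p q → k * p + (c - 1ℤ) * (A^ 2) (e x) y + - θ * (k * q + (c - 1ℤ) * p)) (cong 𝟙 yx∉E) e≡0 ⟩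
    k * 0ℤ + (c - 1ℤ) * (A^ 2) (e x) y + - θ * (k * 0ℤ + (c - 1ℤ) * 0ℤ)     ≡⟨ solve k (c - 1ℤ) θ _ ⟩
    (c - 1ℤ) * (A^ 2) (e x) y
      ≡⟨ cong ((c - 1ℤ) *_) (trans (A^-e 2 x y) (cong +_ (walks-2≡commonNbrs y x))) ⟩
    (c - 1ℤ) * + commonNbrs G y x                                           ∎
    where
      open ≡-Reasoning
      e≡0 : e x y ≡ 0ℤ
      e≡0 with y Fin.≟ x
      ... | yes y≡x = contradiction y≡x y≢x
      ... | no  _   = refl
      solve : ∀ k d θ W → k * 0ℤ + d * W + - θ * (k * 0ℤ + d * 0ℤ) ≡ d * W
      solve = solve-∀

  f-diagonal : ∀ x → f x x ≡ (c - 1ℤ) * k + - θ * k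
  f-diagonal x = begin
    f x x                                                                   ≡⟨ f-value x x ⟩
    k * a x x + (c - 1ℤ) * (A^ 2) (e x) x + - θ * (k * e x x + (c - 1ℤ) * a x x)
      ≡⟨ cong₂ (λ p q → k * p + (c - 1ℤ) * q + - θ * (k * e x x + (c - 1ℤ) * p)) (cong 𝟙 (irrefl G x)) (A^e-diagonal 2 x) ⟩
    k * 0ℤ + (c - 1ℤ) * k + - θ * (k * e x x + (c - 1ℤ) * 0ℤ)
      ≡⟨ cong (λ t → k * 0ℤ + (c - 1ℤ) * k + - θ * (k * t + (c - 1ℤ) * 0ℤ)) e≡1 ⟩
    k * 0ℤ + (c - 1ℤ) * k + - θ * (k * 1ℤ + (c - 1ℤ) * 0ℤ)                 ≡⟨ solve k (c - 1ℤ) θ ⟩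
    (c - 1ℤ) * k + - θ * k                                                  ∎
    where
      open ≡-Reasoning
      e≡1 : e x x ≡ 1ℤ
      e≡1 with x Fin.≟ x
      ... | yes _   = refl
      ... | no  x≢x = contradiction refl x≢x
      solve : ∀ k d θ → k * 0ℤ + d * k + - θ * (k * 1ℤ + d * 0ℤ) ≡ d * k + - θ * k
      solve = solve-∀

  commonNbrs-nonadjacent : ∀ x y → ¬ x ≡ y → adj G x y ≡ false →
    (c - 1ℤ) * + commonNbrs G x y ≡ (c - 1ℤ) * k + - θ * k
  commonNbrs-nonadjacent x y x≢y xy∉E = begin
    (c - 1ℤ) * + commonNbrs G x y    ≡⟨ f-nonadjacent y x x≢y xy∉E ⟨
    f y x                            ≡⟨ constant-on-edges⇒constant (f y) (eigenvector-constant-on-edges (f y) (f-eigenvector y)) x y ⟩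
    f y y                            ≡⟨ f-diagonal y ⟩
    (c - 1ℤ) * k + - θ * k           ∎
    where open ≡-Reasoning

  -- If k = 0, no vertex has a neighbour in C, so all vertices lie in the clique C.
  nonadjacent⇒k≢0 : ∀ {x y} → ¬ x ≡ y → adj G x y ≡ false → ¬ k ≡ 0ℤ
  nonadjacent⇒k≢0 {x} {y} x≢y xy∉E k≡0 = contradiction (trans (sym (C-clique x y (in-C x) (in-C y) x≢y)) xy∉E) λ ()
    where
      in-C : ∀ z → C z ≡ true
      in-C z with C-dominating z
      ... | inj₁ z∈C              = z∈C
      ... | inj₂ (r , _ , zr∈E) = contradiction (trans (cong 𝟙 (sym zr∈E)) a≡0) λ ()
        where
          a≡0 : a z r ≡ 0ℤ
          a≡0 = ∑-nonNegative-≡0 (𝟙-nonNegative ∘ adj G z) (trans (degree z) k≡0) r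

  commonNbrs-nonadjacent-constant : ∀ {x y x' y'} → ¬ x ≡ y → adj G x y ≡ false → ¬ x' ≡ y' → adj G x' y' ≡ false →
    commonNbrs G x y ≡ commonNbrs G x' y'
  commonNbrs-nonadjacent-constant {x} {y} {x'} {y'} x≢y xy∉E x'≢y' x'y'∉E = by-cases (c - 1ℤ ≟ 0ℤ)
    where
      μ-equation : (c - 1ℤ) * + commonNbrs G x y ≡ (c - 1ℤ) * k + - θ * k
      μ-equation = commonNbrs-nonadjacent x y x≢y xy∉E
      μ-equation′ : (c - 1ℤ) * + commonNbrs G x' y' ≡ (c - 1ℤ) * k + - θ * k
      μ-equation′ = commonNbrs-nonadjacent x' y' x'≢y' x'y'∉E
      by-cases : Dec (c - 1ℤ ≡ 0ℤ) → commonNbrs G x y ≡ commonNbrs G x' y'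
      by-cases (no c-1≢0) = +-injective (*-cancelˡ-≡ (c - 1ℤ) (+ commonNbrs G x y) (+ commonNbrs G x' y') {{≢-nonZero c-1≢0}}
                                            (trans μ-equation (sym μ-equation′)))
      by-cases (yes c-1≡0) = contradiction (i*j≡0⇒i≡0∨j≡0 (+ m) mk≡0) [ m≢0 , nonadjacent⇒k≢0 x≢y xy∉E ]′
        where
          solve : ∀ d m k → m * k ≡ d * k + - (d - m) * k
          solve = solve-∀
          mk≡0 : + m * k ≡ 0ℤ
          mk≡0 = trans (solve (c - 1ℤ) (+ m) k) (trans (sym μ-equation) (cong (_* + commonNbrs G x y) c-1≡0))

constant-on-pairs : ∀ {n} {P : Fin n → Fin n → Set} → (∀ x y → Dec (P x y)) → (g : Fin n → Fin n → ℕ) →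
  (∀ {x y x' y'} → P x y → P x' y' → g x y ≡ g x' y') → ∃ λ v → ∀ x y → P x y → g x y ≡ v
constant-on-pairs P? g g-constant with any? (λ x → any? (P? x))
... | yes (x , y , p) = g x y , λ x' y' p' → g-constant p' p
... | no  ∄xy         = 0 , λ x y p → contradiction (x , y , p) ∄xy

strongly-regular : ∀ {n} (G : Graph n) k → (∀ x → count (adj G x) ≡ k) →
  (∀ {x y x' y'} → adj G x y ≡ true → adj G x' y' ≡ true → commonNbrs G x y ≡ commonNbrs G x' y') →
  (∀ {x y x' y'} → ¬ x ≡ y → adj G x y ≡ false → ¬ x' ≡ y' → adj G x' y' ≡ false → commonNbrs G x y ≡ commonNbrs G x' y') →
  IsStronglyRegular G
strongly-regular G k degree λ-constant μ-constant
  with constant-on-pairs (λ x y → adj G x y Bool.≟ true) (commonNbrs G) λ-constant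
     | constant-on-pairs (λ x y → ¬? (x Fin.≟ y) ×-dec (adj G x y Bool.≟ false)) (commonNbrs G)
                         (λ (x≢y , xy∉E) (x'≢y' , x'y'∉E) → μ-constant x≢y xy∉E x'≢y' x'y'∉E)
... | lam , adjacent≡lam | mu , nonadjacent≡mu =
  k , lam , mu , degree , adjacent≡lam , λ x y x≢y xy∉E → nonadjacent≡mu x y (x≢y , xy∉E)

theorem2p32 : ∀ {n : ℕ} (G : Graph n) → WalkRegular 1 G →
    Σ (Fin n → Bool) (λ C → IsRegularClique G C) → IsStronglyRegular G
theorem2p32 {zero}  G _  _ = 0 , 0 , 0 , (λ ()) , (λ ()) , (λ ())
theorem2p32 {suc n} G WR (C , C-clique , m , 1≤m , C-regular) =
  strongly-regular G (walks G 2 fzero fzero) (λ x → trans (degree≡walks-2 x) (walks-diagonal 2 x fzero))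
    commonNbrs-adjacent-constant commonNbrs-nonadjacent-constant
  where
    open AdjacencyOperator G
    open WalkRegular₁ WR
    open RegularClique WR C-clique 1≤m C-regular fzero
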